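{- Let $\Gamma$ be a finite connected simple graph with a perfect matching $\mathcal{M} = \{e_i = \{\alpha_i,\beta_i\} : 1 \le i \le m\}$, $m \ge 2$, such that the setwise stabilizer of $\mathcal{M}$ in $\operatorname{Aut}(\Gamma)$ acts $2$-transitively on the edges of $\mathcal{M}$, and assume $\Gamma[\alpha_1,\beta_1,\alpha_2,\beta_2]$ is isomorphic to $P_4$ or to $K_4 \setminus \{e\}$. If $\Gamma$ is regular, then $m$ is odd; moreover, writing $m = 2k+1$, every vertex has degree $k+1$ if $\Gamma[\alpha_1,\beta_1,\alpha_2,\beta_2] \cong P_4$, and every vertex has degree $3k+1$ if $\Gamma[\alpha_1,\beta_1,\alpha_2,\beta_2] \cong K_4 \setminus \{e\}$.
   Context: $\Gamma[X]$ denotes the subgraph induced on the vertex set $X$. $P_4$ is the path with four vertices and $K_4\setminus\{e\}$ is $K_4$ with one edge removed. -}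

module Defs where

open import Data.Nat using (ℕ; zero; suc; _+_; _*_; _≤_; s≤s; z≤n)
open import Data.Fin using (Fin; zero; suc)
open import Data.Bool using (Bool; true; false; if_then_else_)
open import Data.List using (List; map; allFin)
open import Data.Nat.ListAction using (sum)
open import Data.Sum using (_⊎_)
open import Data.Product using (_×_; Σ; ∃)
open import Function.Bundles using (_↔_; Inverse)
open import Relation.Binary.PropositionalEquality using (_≡_)
open import Data.Empty using (⊥)
open import Relation.Nullary using (¬_)

record Graph (n : ℕ) : Set where
  field
    adj   : Fin n → Fin n → Bool
    sym   : ∀ u v → adj u v ≡ adj v u
    irrefl : ∀ v → adj v v ≡ false
open Graph public

data Walk {n : ℕ} (Γ : Graph n) : Fin n → Fin n → Set where
  here : ∀ {v} → Walk Γ v v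
  step : ∀ {u v w} → adj Γ u v ≡ true → Walk Γ v w → Walk Γ u w

Connected : ∀ {n} → Graph n → Set
Connected Γ = ∀ u v → Walk Γ u v

degree : ∀ {n} → Graph n → Fin n → ℕ
degree {n} Γ v = sum (map (λ w → if adj Γ v w then 1 else 0) (allFin n))

Regular : ∀ {n} → Graph n → Set
Regular Γ = ∃ λ d → ∀ v → degree Γ v ≡ d

-- A perfect matching M = {e_i = {α i, β i} : i ∈ Fin m}: every e_i is an edge
-- and every vertex lies in exactly one edge, i.e. [α , β] : Fin m ⊎ Fin m → Fin n
-- is a bijection.
record PerfectMatching {n : ℕ} (Γ : Graph n) (m : ℕ) : Set where
  field
    α β     : Fin m → Fin n
    isEdge  : ∀ i → adj Γ (α i) (β i) ≡ true
    covers  : ∀ v → Σ (Fin m) λ i → (α i ≡ v) ⊎ (β i ≡ v)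
    disjoint : ∀ i j → (α i ≡ α j ⊎ α i ≡ β j ⊎ β i ≡ α j ⊎ β i ≡ β j) → i ≡ j
    αβ-distinct : ∀ i → α i ≡ β i → ⊥
open PerfectMatching public

record Automorphism {n : ℕ} (Γ : Graph n) : Set where
  field
    perm     : Fin n ↔ Fin n
    preserves : ∀ u v → adj Γ (Inverse.to perm u) (Inverse.to perm v) ≡ adj Γ u v
open Automorphism public

MapsEdge : ∀ {n m} {Γ : Graph n} → PerfectMatching Γ m → Automorphism Γ → Fin m → Fin m → Set
MapsEdge M σ i j =
  (s (α M i) ≡ α M j × s (β M i) ≡ β M j) ⊎ (s (α M i) ≡ β M j × s (β M i) ≡ α M j)
  where s = Inverse.to (perm σ)

Stabilizes : ∀ {n m} {Γ : Graph n} → PerfectMatching Γ m → Automorphism Γ → Set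
Stabilizes {m = m} M σ = ∀ i → Σ (Fin m) λ j → MapsEdge M σ i j

TwoTransitiveOnM : ∀ {n m} {Γ : Graph n} → PerfectMatching Γ m → Set
TwoTransitiveOnM {Γ = Γ} M =
  ∀ i j k l → ¬ i ≡ j → ¬ k ≡ l →
    Σ (Automorphism Γ) λ σ → Stabilizes M σ × MapsEdge M σ i k × MapsEdge M σ j l

idx₁ idx₂ : ∀ {m} → 2 ≤ m → Fin m
idx₁ (s≤s (s≤s _)) = zero
idx₂ (s≤s (s≤s _)) = suc zero

P₄ : Fin 4 → Fin 4 → Bool
P₄ zero (suc zero) = true
P₄ (suc zero) zero = true
P₄ (suc zero) (suc (suc zero)) = true
P₄ (suc (suc zero)) (suc zero) = true
P₄ (suc (suc zero)) (suc (suc (suc zero))) = true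
P₄ (suc (suc (suc zero))) (suc (suc zero)) = true
P₄ _ _ = false

K₄-e : Fin 4 → Fin 4 → Bool
K₄-e zero zero = false
K₄-e (suc zero) (suc zero) = false
K₄-e (suc (suc zero)) (suc (suc zero)) = false
K₄-e (suc (suc (suc zero))) (suc (suc (suc zero))) = false
K₄-e zero (suc (suc (suc zero))) = false
K₄-e (suc (suc (suc zero))) zero = false
K₄-e _ _ = true

quad : ∀ {n m} {Γ : Graph n} → PerfectMatching Γ m → 2 ≤ m → Fin 4 → Fin n
quad M h zero = α M (idx₁ h)
quad M h (suc zero) = β M (idx₁ h)
quad M h (suc (suc zero)) = α M (idx₂ h)
quad M h (suc (suc (suc zero))) = β M (idx₂ h)

-- Γ[α₁,β₁,α₂,β₂] is isomorphic to the graph on Fin 4 with adjacency H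
-- (the four vertices are distinct, so the induced subgraph is the graph on
-- Fin 4 with adjacency adj Γ (quad x) (quad y)).
InducedIso : ∀ {n m} {Γ : Graph n} → PerfectMatching Γ m → 2 ≤ m → (Fin 4 → Fin 4 → Bool) → Set
InducedIso {Γ = Γ} M h H =
  Σ (Fin 4 ↔ Fin 4) λ π → ∀ x y →
    adj Γ (quad M h (Inverse.to π x)) (quad M h (Inverse.to π y)) ≡ H x y

module Submission where

-- Let d be the common degree and c_ij the number of edges between the matching edges e_i and e_j.
-- Counting the neighbours of α_i and β_i according to the matching edge they lie on gives
-- 2d = 2 + Σ_{j≠i} c_ij.  Two-transitivity makes c_ij = c constant, and c is read off from
-- Γ[α₁,β₁,α₂,β₂], which has 2 + c edges: c = 1 for P₄ and c = 3 for K₄-e.  So 2d = 2 + (m-1)c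
-- with c odd, which forces m - 1 = 2k and d = 1 + kc.

open import Defs renaming (sym to adj-sym)
open import Data.Nat using (ℕ; zero; suc; _+_; _*_; _≤_; s≤s; _%_; _/_)
open import Data.Nat.Properties using (+-0-commutativeMonoid; +-commutativeSemigroup; +-comm; +-assoc; *-comm; 0≢1+n; +-cancelˡ-≡; *-cancelˡ-≡; *-cancelʳ-≡)
open import Data.Nat.DivMod using (m≡m%n+[m/n]*n; m%n<n; m*n%n≡0; [m+kn]%n≡m%n)
open import Data.Nat.Tactic.RingSolver using (solve-∀)
import Data.Nat.ListAction as List
open import Data.Fin using (Fin; zero; suc; splitAt; punchIn)
open import Data.Fin.Properties using (+↔⊎; punchInᵢ≢i)
open import Data.Fin.Permutation using (Permutation)
open import Data.Vec.Functional using (_++_)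
open import Data.Bool using (Bool; if_then_else_)
open import Data.List using (tabulate)
open import Data.List.Properties using (map-tabulate)
open import Data.Product using (_×_; ∃; _,_)
open import Data.Sum using (_⊎_; inj₁; inj₂; [_,_]; [_,_]′)
open import Data.Sum.Properties using ([,]-map; [,]-∘)
open import Data.Empty using (⊥-elim)
open import Function using (_∘_; _$_; id)
open import Function.Bundles using (_↔_; Inverse; mk↔ₛ′)
open import Function.Construct.Composition using (_↔-∘_)
open import Relation.Binary.PropositionalEquality using (_≡_; _≢_; refl; sym; trans; cong; cong₂; subst; module ≡-Reasoning)
open ≡-Reasoning
open import Algebra.Properties.CommutativeSemigroup +-commutativeSemigroup using (interchange)
open import Algebra.Properties.CommutativeMonoid.Sum +-0-commutativeMonoid
  using (sum; sum-syntax; sum-cong-≗; ∑-distrib-+; ∑-permute; sum-remove)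

∑-tabulate : ∀ {n} (f : Fin n → ℕ) → List.sum (tabulate f) ≡ sum f
∑-tabulate {zero} f = refl
∑-tabulate {suc n} f = cong (f zero +_) (∑-tabulate (f ∘ suc))

∑-const : ∀ m c → sum {m} (λ _ → c) ≡ m * c
∑-const zero c = refl
∑-const (suc m) c = cong (c +_) (∑-const m c)

∑-++ : ∀ m {k} (f : Fin m → ℕ) (g : Fin k → ℕ) → sum (f ++ g) ≡ sum f + sum g
∑-++ zero f g = refl
∑-++ (suc m) f g = begin
  f zero + sum ((f ++ g) ∘ suc)
    ≡⟨ cong (f zero +_) (sum-cong-≗ ([,]-map ∘ splitAt m)) ⟩
  f zero + sum ((f ∘ suc) ++ g)
    ≡⟨ cong (f zero +_) (∑-++ m (f ∘ suc) g) ⟩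
  f zero + (sum (f ∘ suc) + sum g)
    ≡⟨ sym (+-assoc (f zero) _ _) ⟩
  sum f + sum g ∎

2*[2+_]-injective : ∀ {a b} → 2 * (2 + a) ≡ 2 * (2 + b) → a ≡ b
2*[2+_]-injective {a} {b} eq = +-cancelˡ-≡ 2 a b (*-cancelˡ-≡ (2 + a) (2 + b) 2 eq)

d+d≡2+q*2*c⇒d≡1+q*c : ∀ d q c → d + d ≡ 2 + (q * 2) * c → d ≡ 1 + q * c
d+d≡2+q*2*c⇒d≡1+q*c d q c eq = *-cancelʳ-≡ d (1 + q * c) 2 (trans (double d) (trans eq (expand q c)))
  where
  double : ∀ d → d * 2 ≡ d + d
  double = solve-∀
  expand : ∀ q c → 2 + (q * 2) * c ≡ (1 + q * c) * 2
  expand = solve-∀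

d+d≢2+[1+q*2]*[1+2*t] : ∀ d q t → d + d ≢ 2 + (1 + q * 2) * (1 + 2 * t)
d+d≢2+[1+q*2]*[1+2*t] d q t eq = 0≢1+n $ begin
  0                                     ≡⟨ m*n%n≡0 d 2 ⟨
  (d * 2) % 2                           ≡⟨ cong (_% 2) (trans (double d) (trans eq (expand q t))) ⟩
  (1 + (1 + q + t + 2 * q * t) * 2) % 2 ≡⟨ [m+kn]%n≡m%n 1 (1 + q + t + 2 * q * t) 2 ⟩
  1                                     ∎
  where
  double : ∀ d → d * 2 ≡ d + d
  double = solve-∀
  expand : ∀ q t → 2 + (1 + q * 2) * (1 + 2 * t) ≡ 1 + (1 + q + t + 2 * q * t) * 2
  expand = solve-∀

half-of-2+m*odd : ∀ {d m c} → (∃ λ t → c ≡ 1 + 2 * t) → d + d ≡ 2 + m * c →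
  ∃ λ k → m ≡ 2 * k × d ≡ 1 + k * c
half-of-2+m*odd {d} {m} (t , refl) eq with m % 2 | m≡m%n+[m/n]*n m 2 | m%n<n m 2
... | 0 | m≡2q | _ = m / 2 , trans m≡2q (*-comm (m / 2) 2) ,
  d+d≡2+q*2*c⇒d≡1+q*c d (m / 2) (1 + 2 * t) (subst (λ m → d + d ≡ 2 + m * (1 + 2 * t)) m≡2q eq)
... | 1 | m≡2q+1 | _ = ⊥-elim (d+d≢2+[1+q*2]*[1+2*t] d (m / 2) t
  (subst (λ m → d + d ≡ 2 + m * (1 + 2 * t)) m≡2q+1 eq))
... | suc (suc _) | _ | s≤s (s≤s ())

adjacent : ∀ {n} → Graph n → Fin n → Fin n → ℕ
adjacent Γ u v = if adj Γ u v then 1 else 0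

module _ {n} (Γ : Graph n) where

  degree-∑ : ∀ v → degree Γ v ≡ ∑[ w < n ] adjacent Γ v w
  degree-∑ v = trans (cong List.sum (map-tabulate id (adjacent Γ v))) (∑-tabulate (adjacent Γ v))

  adjacent-sym : ∀ u v → adjacent Γ u v ≡ adjacent Γ v u
  adjacent-sym u v = cong (if_then 1 else 0) (adj-sym Γ u v)

  adjacent-preserved : (σ : Automorphism Γ) → ∀ u v →
    adjacent Γ (Inverse.to (perm σ) u) (Inverse.to (perm σ) v) ≡ adjacent Γ u v
  adjacent-preserved σ u v = cong (if_then 1 else 0) (preserves σ u v)

module _ {n m} {Γ : Graph n} (M : PerfectMatching Γ m) where

  endpoint : Fin m ⊎ Fin m → Fin n
  endpoint = [ α M , β M ]

  edgeOf : Fin n → Fin m ⊎ Fin m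
  edgeOf v with covers M v
  ... | i , inj₁ _ = inj₁ i
  ... | i , inj₂ _ = inj₂ i

  endpoint-edgeOf : ∀ v → endpoint (edgeOf v) ≡ v
  endpoint-edgeOf v with covers M v
  ... | _ , inj₁ αi≡v = αi≡v
  ... | _ , inj₂ βi≡v = βi≡v

  edgeOf-endpoint : ∀ x → edgeOf (endpoint x) ≡ x
  edgeOf-endpoint (inj₁ i) with covers M (α M i)
  ... | j , inj₁ αj≡αi = cong inj₁ (disjoint M j i (inj₁ αj≡αi))
  ... | j , inj₂ βj≡αi = ⊥-elim (αβ-distinct M i
         (sym (subst (λ k → β M k ≡ α M i) (disjoint M j i (inj₂ (inj₂ (inj₁ βj≡αi)))) βj≡αi)))
  edgeOf-endpoint (inj₂ i) with covers M (β M i)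
  ... | j , inj₁ αj≡βi = ⊥-elim (αβ-distinct M i
         (subst (λ k → α M k ≡ β M i) (disjoint M j i (inj₂ (inj₁ αj≡βi))) αj≡βi))
  ... | j , inj₂ βj≡βi = cong inj₂ (disjoint M j i (inj₂ (inj₂ (inj₂ βj≡βi))))

  endpoint↔ : (Fin m ⊎ Fin m) ↔ Fin n
  endpoint↔ = mk↔ₛ′ endpoint edgeOf endpoint-edgeOf edgeOf-endpoint

  ∑-endpoints : (f : Fin n → ℕ) → ∑[ v < n ] f v ≡ ∑[ i < m ] (f (α M i) + f (β M i))
  ∑-endpoints f = begin
    sum f                                          ≡⟨ ∑-permute f (endpoint↔ ↔-∘ +↔⊎) ⟩
    sum (λ x → f (endpoint (splitAt m x)))         ≡⟨ sum-cong-≗ ([,]-∘ f ∘ splitAt m) ⟩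
    sum ((f ∘ α M) ++ (f ∘ β M))                   ≡⟨ ∑-++ m (f ∘ α M) (f ∘ β M) ⟩
    sum (f ∘ α M) + sum (f ∘ β M)                  ≡⟨ sym (∑-distrib-+ (f ∘ α M) (f ∘ β M)) ⟩
    ∑[ i < m ] (f (α M i) + f (β M i))             ∎

  endsAdjacent : Fin m → Fin n → ℕ
  endsAdjacent i v = adjacent Γ (α M i) v + adjacent Γ (β M i) v

  -- For i ≢ j this counts the edges joining e_i and e_j; edgesBetween i i = 2 counts e_i from both ends.
  edgesBetween : Fin m → Fin m → ℕ
  edgesBetween i j = endsAdjacent i (α M j) + endsAdjacent i (β M j)

  edgesBetween-self : ∀ i → edgesBetween i i ≡ 2
  edgesBetween-self i
    rewrite irrefl Γ (α M i) | irrefl Γ (β M i) | adj-sym Γ (β M i) (α M i) | isEdge M i = refl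

  edgesBetween-sym : ∀ i j → edgesBetween i j ≡ edgesBetween j i
  edgesBetween-sym i j = begin
    (A (α M i) (α M j) + A (β M i) (α M j)) + (A (α M i) (β M j) + A (β M i) (β M j))
      ≡⟨ interchange (A (α M i) (α M j)) (A (β M i) (α M j)) (A (α M i) (β M j)) (A (β M i) (β M j)) ⟩
    (A (α M i) (α M j) + A (α M i) (β M j)) + (A (β M i) (α M j) + A (β M i) (β M j))
      ≡⟨ cong₂ _+_ (cong₂ _+_ (adjacent-sym Γ _ _) (adjacent-sym Γ _ _))
                   (cong₂ _+_ (adjacent-sym Γ _ _) (adjacent-sym Γ _ _)) ⟩
    edgesBetween j i ∎
    where
    A : Fin n → Fin n → ℕ
    A = adjacent Γ

  degree-endpoints : ∀ i → degree Γ (α M i) + degree Γ (β M i) ≡ ∑[ j < m ] edgesBetween i j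
  degree-endpoints i = begin
    degree Γ (α M i) + degree Γ (β M i)
      ≡⟨ cong₂ _+_ (degree-∑ Γ (α M i)) (degree-∑ Γ (β M i)) ⟩
    sum (adjacent Γ (α M i)) + sum (adjacent Γ (β M i))
      ≡⟨ sym (∑-distrib-+ (adjacent Γ (α M i)) (adjacent Γ (β M i))) ⟩
    sum (endsAdjacent i)
      ≡⟨ ∑-endpoints (endsAdjacent i) ⟩
    ∑[ j < m ] edgesBetween i j ∎

  module _ (σ : Automorphism Γ) where
    private
      s : Fin n → Fin n
      s = Inverse.to (perm σ)

    endsAdjacent-invariant : ∀ {i i'} → MapsEdge M σ i i' → ∀ v →
      endsAdjacent i' (s v) ≡ endsAdjacent i v
    endsAdjacent-invariant {i} (inj₁ (αi↦αi' , βi↦βi')) v rewrite sym αi↦αi' | sym βi↦βi' =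
      cong₂ _+_ (adjacent-preserved Γ σ (α M i) v) (adjacent-preserved Γ σ (β M i) v)
    endsAdjacent-invariant {i} (inj₂ (αi↦βi' , βi↦αi')) v rewrite sym αi↦βi' | sym βi↦αi' =
      trans (+-comm (adjacent Γ (s (β M i)) (s v)) (adjacent Γ (s (α M i)) (s v)))
            (cong₂ _+_ (adjacent-preserved Γ σ (α M i) v) (adjacent-preserved Γ σ (β M i) v))

    edgesBetween-invariant : ∀ {i i' j j'} → MapsEdge M σ i i' → MapsEdge M σ j j' →
      edgesBetween i' j' ≡ edgesBetween i j
    edgesBetween-invariant {j = j} i↦i' (inj₁ (αj↦αj' , βj↦βj')) rewrite sym αj↦αj' | sym βj↦βj' =
      cong₂ _+_ (endsAdjacent-invariant i↦i' (α M j)) (endsAdjacent-invariant i↦i' (β M j))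
    edgesBetween-invariant {i' = i'} {j = j} i↦i' (inj₂ (αj↦βj' , βj↦αj')) rewrite sym αj↦βj' | sym βj↦αj' =
      trans (+-comm (endsAdjacent i' (s (β M j))) (endsAdjacent i' (s (α M j))))
            (cong₂ _+_ (endsAdjacent-invariant i↦i' (α M j)) (endsAdjacent-invariant i↦i' (β M j)))

  edgesBetween-constant : TwoTransitiveOnM M → ∀ {i j k l} → i ≢ j → k ≢ l →
    edgesBetween k l ≡ edgesBetween i j
  edgesBetween-constant transitive {i} {j} {k} {l} i≢j k≢l with transitive i j k l i≢j k≢l
  ... | σ , _ , i↦k , j↦l = edgesBetween-invariant σ i↦k j↦l

degree-endpoints-uniform : ∀ {n m c} {Γ : Graph n} (M : PerfectMatching Γ (suc m)) i →
  (∀ j → j ≢ i → edgesBetween M i j ≡ c) →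
  degree Γ (α M i) + degree Γ (β M i) ≡ 2 + m * c
degree-endpoints-uniform {m = m} {c} {Γ} M i uniform = begin
  degree Γ (α M i) + degree Γ (β M i)                 ≡⟨ degree-endpoints M i ⟩
  sum (edgesBetween M i)                              ≡⟨ sum-remove {i = i} (edgesBetween M i) ⟩
  edgesBetween M i i + ∑[ j < m ] edgesBetween M i (punchIn i j)
    ≡⟨ cong₂ _+_ (edgesBetween-self M i) (sum-cong-≗ λ j → uniform (punchIn i j) (punchInᵢ≢i i j)) ⟩
  2 + sum {m} (λ _ → c)                               ≡⟨ cong (2 +_) (∑-const m c) ⟩
  2 + m * c                                           ∎

∑∑-permute : ∀ {k n} (π : Permutation k n) (F : Fin n → Fin n → ℕ) →
  ∑[ x < n ] ∑[ y < n ] F x y ≡ ∑[ x < k ] ∑[ y < k ] F (Inverse.to π x) (Inverse.to π y)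
∑∑-permute π F = trans (∑-permute _ π) (sum-cong-≗ λ x → ∑-permute (F (Inverse.to π x)) π)

module _ {n m} {Γ : Graph n} (M : PerfectMatching Γ m) (h : 2 ≤ m) where
  private
    i₁ i₂ : Fin m
    i₁ = idx₁ h
    i₂ = idx₂ h

  ∑-quad : (g : Fin n → ℕ) →
    ∑[ x < 4 ] g (quad M h x) ≡ (g (α M i₁) + g (β M i₁)) + (g (α M i₂) + g (β M i₂))
  ∑-quad g = reassociate (g (α M i₁)) (g (β M i₁)) (g (α M i₂)) (g (β M i₂))
    where
    reassociate : ∀ a b c d → a + (b + (c + (d + 0))) ≡ (a + b) + (c + d)
    reassociate = solve-∀

  quad-adjacency-sum :
    ∑[ x < 4 ] ∑[ y < 4 ] adjacent Γ (quad M h x) (quad M h y) ≡ 2 * (2 + edgesBetween M i₁ i₂)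
  quad-adjacency-sum = begin
    ∑[ x < 4 ] ∑[ y < 4 ] adjacent Γ (quad M h x) (quad M h y)
      ≡⟨ ∑-quad (λ u → ∑[ y < 4 ] adjacent Γ u (quad M h y)) ⟩
    (row (α M i₁) + row (β M i₁)) + (row (α M i₂) + row (β M i₂))
      ≡⟨ cong₂ _+_ (sym (∑-distrib-+ (column (α M i₁)) (column (β M i₁))))
                   (sym (∑-distrib-+ (column (α M i₂)) (column (β M i₂)))) ⟩
    ∑[ y < 4 ] endsAdjacent M i₁ (quad M h y) + ∑[ y < 4 ] endsAdjacent M i₂ (quad M h y)
      ≡⟨ cong₂ _+_ (∑-quad (endsAdjacent M i₁)) (∑-quad (endsAdjacent M i₂)) ⟩
    (edgesBetween M i₁ i₁ + edgesBetween M i₁ i₂) + (edgesBetween M i₂ i₁ + edgesBetween M i₂ i₂)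
      ≡⟨ cong₂ _+_ (cong (_+ c) (edgesBetween-self M i₁))
                   (cong₂ _+_ (edgesBetween-sym M i₂ i₁) (edgesBetween-self M i₂)) ⟩
    (2 + c) + (c + 2)
      ≡⟨ double c ⟩
    2 * (2 + c) ∎
    where
    c : ℕ
    c = edgesBetween M i₁ i₂
    column : Fin n → Fin 4 → ℕ
    column u y = adjacent Γ u (quad M h y)
    row : Fin n → ℕ
    row u = sum (column u)
    double : ∀ c → (2 + c) + (c + 2) ≡ 2 * (2 + c)
    double = solve-∀

  induced-adjacency-sum : (H : Fin 4 → Fin 4 → Bool) → InducedIso M h H →
    ∑[ x < 4 ] ∑[ y < 4 ] (if H x y then 1 else 0) ≡ 2 * (2 + edgesBetween M i₁ i₂)
  induced-adjacency-sum H (π , iso) = begin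
    ∑[ x < 4 ] ∑[ y < 4 ] (if H x y then 1 else 0)
      ≡⟨ sum-cong-≗ (λ x → sum-cong-≗ λ y → cong (if_then 1 else 0) (sym (iso x y))) ⟩
    ∑[ x < 4 ] ∑[ y < 4 ] adjacent Γ (quad M h (Inverse.to π x)) (quad M h (Inverse.to π y))
      ≡⟨ sym (∑∑-permute π (λ x y → adjacent Γ (quad M h x) (quad M h y))) ⟩
    ∑[ x < 4 ] ∑[ y < 4 ] adjacent Γ (quad M h x) (quad M h y)
      ≡⟨ quad-adjacency-sum ⟩
    2 * (2 + edgesBetween M i₁ i₂) ∎

  -- Each edge is counted twice: P₄ has 3 edges, K₄-e has 5, and Γ[α₁,β₁,α₂,β₂] has 2 + edgesBetween M i₁ i₂.
  edgesBetween-P₄ : InducedIso M h P₄ → edgesBetween M i₁ i₂ ≡ 1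
  edgesBetween-P₄ iso = sym (2*[2+_]-injective (induced-adjacency-sum P₄ iso))

  edgesBetween-K₄-e : InducedIso M h K₄-e → edgesBetween M i₁ i₂ ≡ 3
  edgesBetween-K₄-e iso = sym (2*[2+_]-injective (induced-adjacency-sum K₄-e iso))

idx₁≢idx₂ : ∀ {m} (h : 2 ≤ m) → idx₁ h ≢ idx₂ h
idx₁≢idx₂ (s≤s (s≤s _)) ()

lemma6p13 : ∀ {n m} (Γ : Graph n) (M : PerfectMatching Γ m) (h : 2 ≤ m) →
    Connected Γ → TwoTransitiveOnM M →
    (InducedIso M h P₄ ⊎ InducedIso M h K₄-e) →
    Regular Γ →
    ∃ λ k → (m ≡ 2 * k + 1)
      × (InducedIso M h P₄ → ∀ v → degree Γ v ≡ k + 1)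
      × (InducedIso M h K₄-e → ∀ v → degree Γ v ≡ 3 * k + 1)
lemma6p13 {m = suc m} Γ M h@(s≤s _) _ transitive shape (d , regular) =
  let k , m≡2k , d≡1+kc = half-of-2+m*odd {d} {m} {c} c-odd d+d≡2+m*c
  in k , trans (cong suc m≡2k) (+-comm 1 (2 * k))
       , (λ iso v → trans (degree-formula {k} d≡1+kc (edgesBetween-P₄ M h iso) v) (P₄-degree k))
       , (λ iso v → trans (degree-formula {k} d≡1+kc (edgesBetween-K₄-e M h iso) v) (K₄-e-degree k))
  where
  i₁ : Fin (suc m)
  i₁ = idx₁ h
  c : ℕ
  c = edgesBetween M i₁ (idx₂ h)

  c-odd : ∃ λ t → c ≡ 1 + 2 * t
  c-odd = [ (λ iso → 0 , edgesBetween-P₄ M h iso) , (λ iso → 1 , edgesBetween-K₄-e M h iso) ]′ shape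

  d+d≡2+m*c : d + d ≡ 2 + m * c
  d+d≡2+m*c = begin
    d + d                                 ≡⟨ cong₂ _+_ (regular (α M i₁)) (regular (β M i₁)) ⟨
    degree Γ (α M i₁) + degree Γ (β M i₁) ≡⟨ degree-endpoints-uniform M i₁ (λ j j≢i₁ →
                                                edgesBetween-constant M transitive (idx₁≢idx₂ h) (j≢i₁ ∘ sym)) ⟩
    2 + m * c                             ∎

  degree-formula : ∀ {k c₀} → d ≡ 1 + k * c → c ≡ c₀ → ∀ v → degree Γ v ≡ 1 + k * c₀
  degree-formula {k} d≡1+kc c≡c₀ v = trans (regular v) (trans d≡1+kc (cong (λ c → 1 + k * c) c≡c₀))

  P₄-degree : ∀ k → 1 + k * 1 ≡ k + 1
  P₄-degree = solve-∀

  K₄-e-degree : ∀ k → 1 + k * 3 ≡ 3 * k + 1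
  K₄-e-degree = solve-∀
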